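{- Let $F$ be a graph on $r$ vertices. If $\mathcal{H}$ is an $F$-free hypergraph on $n$ vertices such that each hyperedge has size at least $r^3$, then $$\sum_{h\in\mathcal{H}}|h| \le 2\binom{n}{2} + r^3|\mathcal{H}|.$$
   Context: Hypergraphs are finite and may contain multi-hyperedges; $|\mathcal{H}|$ is the number of hyperedges. For a graph $G$, a hypergraph $\mathcal{B}$ is a Berge-$G$ if there is a bijection $f:E(G)\to E(\mathcal{B})$ with $e\subseteq f(e)$ for every $e\in E(G)$ (vertices of $G$ identified with distinct vertices of the hypergraph). A hypergraph is $G$-free if no subfamily of its hyperedges is a Berge-$G$. -}

module Defs where

open import Data.Nat using (ℕ)
open import Data.Bool using (Bool; true; false)
open import Data.Fin using (Fin; _<_)
open import Data.Fin.Subset using (Subset; _∈_)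
open import Data.List using (List; length; lookup)
open import Data.Product using (Σ; _×_; _,_)
open import Relation.Binary.PropositionalEquality using (_≡_)
open import Relation.Nullary using (¬_)
open import Function.Definitions using (Injective)

record Graph (r : ℕ) : Set where
  field
    adj     : Fin r → Fin r → Bool
    adj-sym : ∀ i j → adj i j ≡ adj j i
    adj-irr : ∀ i → adj i i ≡ false
open Graph public

-- Edges of G: unordered pairs {i,j}, represented canonically with i < j.
Edge : ∀ {r} → Graph r → Set
Edge {r} G = Σ (Fin r) λ i → Σ (Fin r) λ j → (i < j) × (adj G i j ≡ true)

edge-ends : ∀ {r} {G : Graph r} → Edge G → Fin r × Fin r
edge-ends (i , j , _ , _) = i , j

-- A hypergraph on vertex set Fin n: a finite list (multiset) of hyperedges.
Hypergraph : ℕ → Set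
Hypergraph n = List (Subset n)

-- H contains a Berge-G: an injective vertex embedding φ and an injective
-- assignment of edges of G to (indices of) hyperedges of H, so that each
-- edge {i,j} is contained in its assigned hyperedge.
ContainsBerge : ∀ {r n} → Graph r → Hypergraph n → Set
ContainsBerge {r} {n} G H =
  Σ (Fin r → Fin n) λ φ →
  Σ (Edge G → Fin (length H)) λ g →
    Injective _≡_ _≡_ φ ×
    (∀ e e′ → g e ≡ g e′ → edge-ends {G = G} e ≡ edge-ends {G = G} e′) ×
    (∀ (e : Edge G) → let (i , j) = edge-ends {G = G} e in
        (φ i ∈ lookup H (g e)) × (φ j ∈ lookup H (g e)))

Free : ∀ {r n} → Graph r → Hypergraph n → Set
Free G H = ¬ ContainsBerge G H

module Submission where

-- We record, for the hyperedges h₀, h₁, … of H, a partial colouring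
-- of the pairs of vertices: a pair may get colour k only if it lies inside hₖ,
-- and each colour class is a matching.  The hyperedges are added one at a time;
-- the new hyperedge h greedily colours uncoloured pairs inside h with its own
-- colour, deleting both endpoints from the set S of still available vertices,
-- until every pair inside S is coloured.  Each deletion of two vertices creates
-- two new coloured ordered pairs, so ∣h∣ ≤ (new coloured ordered pairs) + ∣S∣.
-- A fully coloured set of size ≥ r³ contains a rainbow K_r (grown greedily,
-- the matching property limiting the blocked vertices to k(1 + k²)), and a
-- rainbow K_r is a Berge copy of every graph on r vertices; hence ∣S∣ < r³ for
-- F-free H.  Summing, Σ∣h∣ ≤ (coloured ordered pairs) + r³∣H∣, and a loopless
-- colouring has at most n(n-1) = 2·C(n,2) coloured ordered pairs.

open import Defs
open import Data.Nat using (ℕ; zero; suc; _+_; _*_; _^_; _≤_; _<_; z≤n; s≤s)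
open import Data.Nat.Properties hiding (_≟_; suc-injective; <⇒≢)
open import Data.Nat.Combinatorics using (_C_; nCk+nC[k+1]≡[n+1]C[k+1]; nC1≡n)
open import Data.Nat.Solver using (module +-*-Solver)
open import Data.Nat.ListAction using (sum)
open import Data.Fin using (Fin; zero; suc; combine)
import Data.Fin as Fin
open import Data.Fin.Properties using (_≟_; suc-injective; injective⇒≤; any?; combine-injective; <⇒≢)
open import Data.Fin.Subset using (Subset; _∈_; _∉_; ∣_∣; inside; outside; _-_)
open import Data.Fin.Subset.Properties using (_∈?_; p─q⊆p; p─⊥≡p; x∈p∧x≢y⇒x∈p-y)
open import Data.Vec using ([]; _∷_; here; there)
open import Data.List using ([]; _∷_; length; lookup; map)
open import Data.List.Relation.Unary.All using (All)
open import Data.Maybe using (Maybe; just; nothing)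
import Data.Maybe as Maybe
open import Data.Maybe.Properties using (≡-dec)
open import Data.Product using (Σ; _×_; _,_; proj₁; proj₂)
open import Data.Sum using (_⊎_; inj₁; inj₂)
open import Function using (_∘_)
open import Function.Definitions using (Injective)
open import Relation.Binary.PropositionalEquality
open import Relation.Nullary using (¬_; Dec; yes; no; contradiction)
open import Relation.Nullary.Decidable using (_×-dec_; _⊎-dec_; ¬?; decidable-stable)

sumF : ∀ n → (Fin n → ℕ) → ℕ
sumF zero    f = 0
sumF (suc n) f = f zero + sumF n (f ∘ suc)

sumF-cong : ∀ n {f g : Fin n → ℕ} → (∀ i → f i ≡ g i) → sumF n f ≡ sumF n g
sumF-cong zero    f≡g = refl
sumF-cong (suc n) f≡g = cong₂ _+_ (f≡g zero) (sumF-cong n (f≡g ∘ suc))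

sumF-mono : ∀ n {f g : Fin n → ℕ} → (∀ i → f i ≤ g i) → sumF n f ≤ sumF n g
sumF-mono zero    f≤g = z≤n
sumF-mono (suc n) f≤g = +-mono-≤ (f≤g zero) (sumF-mono n (f≤g ∘ suc))

sumF-strict : ∀ n {f g : Fin n → ℕ} (i : Fin n) →
  (∀ j → f j ≤ g j) → f i < g i → suc (sumF n f) ≤ sumF n g
sumF-strict (suc n) zero    f≤g fi<gi = +-mono-≤ fi<gi (sumF-mono n (f≤g ∘ suc))
sumF-strict (suc n) {f} {g} (suc i) f≤g fi<gi =
  subst (_≤ sumF (suc n) g) (+-suc (f zero) _) (+-mono-≤ (f≤g zero) (sumF-strict n i (f≤g ∘ suc) fi<gi))

-- Strict at two distinct points gains at least two: pass through the function
-- that agrees with g at i and with f elsewhere.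
sumF-strict₂ : ∀ n {f g : Fin n → ℕ} (i j : Fin n) → i ≢ j →
  (∀ k → f k ≤ g k) → f i < g i → f j < g j → 2 + sumF n f ≤ sumF n g
sumF-strict₂ n {f} {g} i j i≢j f≤g fi<gi fj<gj =
  ≤-trans (s≤s (sumF-strict n i f≤mid fi<midi)) (sumF-strict n j mid≤g midj<gj)
  where
  mid : Fin n → ℕ
  mid k with k ≟ i
  ... | yes _ = g k
  ... | no  _ = f k
  f≤mid : ∀ k → f k ≤ mid k
  f≤mid k with k ≟ i
  ... | yes _ = f≤g k
  ... | no  _ = ≤-refl
  mid≤g : ∀ k → mid k ≤ g k
  mid≤g k with k ≟ i
  ... | yes _ = ≤-refl
  ... | no  _ = f≤g k
  fi<midi : f i < mid i
  fi<midi with i ≟ i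
  ... | yes _   = fi<gi
  ... | no  i≢i = contradiction refl i≢i
  midj<gj : mid j < g j
  midj<gj with j ≟ i
  ... | yes j≡i = contradiction (sym j≡i) i≢j
  ... | no  _   = fj<gj

sumF-indicator : ∀ n {f : Fin n → ℕ} (i : Fin n) → (∀ j → f j ≤ 1) → f i ≡ 0 → sumF n f < n
sumF-indicator (suc n) {f} zero    f≤1 fi≡0 rewrite fi≡0 = s≤s (sumF-≤1 n (f≤1 ∘ suc))
  where
  sumF-≤1 : ∀ n {f : Fin n → ℕ} → (∀ j → f j ≤ 1) → sumF n f ≤ n
  sumF-≤1 zero    _   = z≤n
  sumF-≤1 (suc n) f≤1 = +-mono-≤ (f≤1 zero) (sumF-≤1 n (f≤1 ∘ suc))
sumF-indicator (suc n) {f} (suc i) f≤1 fi≡0 =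
  subst (_≤ suc n) (+-suc (f zero) _) (+-mono-≤ (f≤1 zero) (sumF-indicator n i (f≤1 ∘ suc) fi≡0))

sumF-bound : ∀ n {m} {f : Fin n → ℕ} → (∀ i → f i < m) → n + sumF n f ≤ n * m
sumF-bound zero    _    = z≤n
sumF-bound (suc n) {m} {f} f<m = begin
  suc n + (f zero + sumF n (f ∘ suc))   ≡⟨ cong suc (+-comm-middle n (f zero) _) ⟩
  suc (f zero) + (n + sumF n (f ∘ suc)) ≤⟨ +-mono-≤ (f<m zero) (sumF-bound n (f<m ∘ suc)) ⟩
  m + n * m                             ∎
  where
  open ≤-Reasoning
  +-comm-middle : ∀ a b c → a + (b + c) ≡ b + (a + c)
  +-comm-middle a b c = trans (sym (+-assoc a b c)) (trans (cong (_+ c) (+-comm a b)) (+-assoc b a c))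

2·nC2+n≡n² : ∀ n → 2 * (n C 2) + n ≡ n * n
2·nC2+n≡n² zero    = refl
2·nC2+n≡n² (suc n) = begin
  2 * (suc n C 2) + suc n       ≡⟨ cong (λ t → 2 * t + suc n) (sym (nCk+nC[k+1]≡[n+1]C[k+1] n 1)) ⟩
  2 * (n C 1 + n C 2) + suc n   ≡⟨ cong (λ t → 2 * (t + n C 2) + suc n) (nC1≡n n) ⟩
  2 * (n + n C 2) + suc n       ≡⟨ regroup n (n C 2) ⟩
  (2 * (n C 2) + n) + suc (2 * n) ≡⟨ cong (_+ suc (2 * n)) (2·nC2+n≡n² n) ⟩
  n * n + suc (2 * n)           ≡⟨ square n ⟩
  suc n * suc n                 ∎
  where
  open ≡-Reasoning
  open +-*-Solver
  regroup : ∀ n c → 2 * (n + c) + suc n ≡ (2 * c + n) + suc (2 * n)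
  regroup = solve 2 (λ n c → con 2 :* (n :+ c) :+ (con 1 :+ n) := (con 2 :* c :+ n) :+ (con 1 :+ con 2 :* n)) refl
  square : ∀ n → n * n + suc (2 * n) ≡ suc n * suc n
  square = solve 1 (λ n → n :* n :+ (con 1 :+ con 2 :* n) := (con 1 :+ n) :* (con 1 :+ n)) refl

∣p∣≡1+∣p-x∣ : ∀ {n} (p : Subset n) {x} → x ∈ p → ∣ p ∣ ≡ suc ∣ p - x ∣
∣p∣≡1+∣p-x∣ (inside  ∷ p) here        = cong (suc ∘ ∣_∣) (sym (p─⊥≡p p))
∣p∣≡1+∣p-x∣ (inside  ∷ p) (there x∈p) = cong suc (∣p∣≡1+∣p-x∣ p x∈p)
∣p∣≡1+∣p-x∣ (outside ∷ p) (there x∈p) = ∣p∣≡1+∣p-x∣ p x∈p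

x∉p-x : ∀ {n} (p : Subset n) (x : Fin n) → x ∉ p - x
x∉p-x (_ ∷ p) zero    ()
x∉p-x (_ ∷ p) (suc x) (there x∈p-x) = x∉p-x p x x∈p-x

enumerate : ∀ {n} (S : Subset n) → Σ (Fin ∣ S ∣ → Fin n) λ e → (∀ i → e i ∈ S) × Injective _≡_ _≡_ e
enumerate []            = (λ ()) , (λ ()) , λ {}
enumerate (inside ∷ S)  with enumerate S
... | e , e∈S , e-inj = e′ , e′∈S , e′-inj
  where
  e′ : Fin (suc ∣ S ∣) → Fin _
  e′ zero    = zero
  e′ (suc i) = suc (e i)
  e′∈S : ∀ i → e′ i ∈ inside ∷ S
  e′∈S zero    = here
  e′∈S (suc i) = there (e∈S i)
  e′-inj : Injective _≡_ _≡_ e′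
  e′-inj {zero}  {zero}  _  = refl
  e′-inj {suc i} {suc j} eq = cong suc (e-inj (suc-injective eq))
  e′-inj {zero}  {suc _} ()
  e′-inj {suc _} {zero}  ()
enumerate (outside ∷ S) with enumerate S
... | e , e∈S , e-inj = suc ∘ e , there ∘ e∈S , e-inj ∘ suc-injective

injective-on⇒∣S∣≤ : ∀ {n m} (S : Subset n) (f : ∀ x → x ∈ S → Fin m) →
  (∀ x y x∈S y∈S → f x x∈S ≡ f y y∈S → x ≡ y) → ∣ S ∣ ≤ m
injective-on⇒∣S∣≤ S f f-inj with enumerate S
... | e , e∈S , e-inj = injective⇒≤ {f = λ i → f (e i) (e∈S i)} (e-inj ∘ f-inj _ _ _ _)

-- A partial colouring of the pairs of vertices Fin n by colours Fin m
-- (nothing = uncoloured).  The colours will be the indices of hyperedges.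
Colouring : ℕ → ℕ → Set
Colouring n m = Fin n → Fin n → Maybe (Fin m)

record IsColouring {n} (H : Hypergraph n) (c : Colouring n (length H)) : Set where
  field
    symmetric : ∀ u v → c u v ≡ c v u
    loopless  : ∀ u → c u u ≡ nothing
    matching  : ∀ u v w {k} → c u v ≡ just k → c u w ≡ just k → v ≡ w
    within    : ∀ u v {k} → c u v ≡ just k → u ∈ lookup H k × v ∈ lookup H k
open IsColouring

isColoured : ∀ {A : Set} → Maybe A → ℕ
isColoured nothing  = 0
isColoured (just _) = 1

isColoured≤1 : ∀ {A : Set} (x : Maybe A) → isColoured x ≤ 1
isColoured≤1 nothing  = z≤n
isColoured≤1 (just _) = s≤s z≤n

colouredPairs : ∀ {n m} → Colouring n m → ℕ
colouredPairs {n} c = sumF n λ u → sumF n λ v → isColoured (c u v)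

colouredPairs-bound : ∀ {n m} (c : Colouring n m) → (∀ u → c u u ≡ nothing) →
  colouredPairs c ≤ 2 * (n C 2)
colouredPairs-bound {n} c loopless = +-cancelˡ-≤ n _ _ (begin
  n + colouredPairs c ≤⟨ sumF-bound n row<n ⟩
  n * n               ≡⟨ sym (2·nC2+n≡n² n) ⟩
  2 * (n C 2) + n     ≡⟨ +-comm (2 * (n C 2)) n ⟩
  n + 2 * (n C 2)     ∎)
  where
  open ≤-Reasoning
  row<n : ∀ u → sumF n (λ v → isColoured (c u v)) < n
  row<n u = sumF-indicator n u (λ v → isColoured≤1 (c u v)) (cong isColoured (loopless u))

IsPair : ∀ {n} → Fin n → Fin n → Fin n → Fin n → Set
IsPair u v x y = (x ≡ u × y ≡ v) ⊎ (x ≡ v × y ≡ u)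

isPair? : ∀ {n} (u v x y : Fin n) → Dec (IsPair u v x y)
isPair? u v x y = ((x ≟ u) ×-dec (y ≟ v)) ⊎-dec ((x ≟ v) ×-dec (y ≟ u))

IsPair-swap : ∀ {n} {u v x y : Fin n} → IsPair u v x y → IsPair u v y x
IsPair-swap (inj₁ (x≡u , y≡v)) = inj₂ (y≡v , x≡u)
IsPair-swap (inj₂ (x≡v , y≡u)) = inj₁ (y≡u , x≡v)

recolour : ∀ {n m} → Colouring n m → Fin n → Fin n → Fin m → Colouring n m
recolour c u v k x y with isPair? u v x y
... | yes _ = just k
... | no  _ = c x y

recolour-cases : ∀ {n m} (c : Colouring n m) u v k x y →
  (IsPair u v x y × recolour c u v k x y ≡ just k) ⊎
  (¬ IsPair u v x y × recolour c u v k x y ≡ c x y)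
recolour-cases c u v k x y with isPair? u v x y
... | yes p = inj₁ (p , refl)
... | no ¬p = inj₂ (¬p , refl)

recolour-count : ∀ {n m} (c : Colouring n m) {u v} k → u ≢ v →
  c u v ≡ nothing → c v u ≡ nothing → 2 + colouredPairs c ≤ colouredPairs (recolour c u v k)
recolour-count {n} c {u} {v} k u≢v uv-free vu-free =
  sumF-strict₂ n u v u≢v (λ x → sumF-mono n (grows x))
    (sumF-strict n v (grows u) (grows-strictly (inj₁ (refl , refl)) uv-free))
    (sumF-strict n u (grows v) (grows-strictly (inj₂ (refl , refl)) vu-free))
  where
  c′ = recolour c u v k
  grows : ∀ x y → isColoured (c x y) ≤ isColoured (c′ x y)
  grows x y with recolour-cases c u v k x y
  ... | inj₁ (_ , c′xy≡k) rewrite c′xy≡k = isColoured≤1 (c x y)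
  ... | inj₂ (_ , c′xy≡c) rewrite c′xy≡c = ≤-refl
  grows-strictly : ∀ {x y} → IsPair u v x y → c x y ≡ nothing → isColoured (c x y) < isColoured (c′ x y)
  grows-strictly {x} {y} p cxy-free with recolour-cases c u v k x y
  ... | inj₁ (_ , c′xy≡k) rewrite c′xy≡k | cxy-free = s≤s z≤n
  ... | inj₂ (¬p , _)     = contradiction p ¬p

FullyColoured : ∀ {n m} → Colouring n m → Subset n → Set
FullyColoured c S = ∀ x y → x ∈ S → y ∈ S → x ≢ y → c x y ≢ nothing

module Saturation {n} (H : Hypergraph n) (k : Fin (length H)) where

  -- The vertices S of h still available to colour k: colour k does not touch them.
  record Invariant (c : Colouring n (length H)) (S : Subset n) : Set where
    field
      colouring : IsColouring H c
      S⊆h       : ∀ {x} → x ∈ S → x ∈ lookup H k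
      S-fresh   : ∀ x y → c x y ≡ just k → x ∉ S
  open Invariant

  -- This keeps the invariant, and the two vertices leaving S
  -- are paid for by the two new coloured ordered pairs.
  module Step {c S} (I : Invariant c S) {u v} (u∈S : u ∈ S) (v∈S : v ∈ S)
              (u≢v : u ≢ v) (uv-free : c u v ≡ nothing) where

    c′ : Colouring n (length H)
    c′ = recolour c u v k

    S′ : Subset n
    S′ = (S - u) - v

    S′⊆S : ∀ {x} → x ∈ S′ → x ∈ S
    S′⊆S = p─q⊆p S _ ∘ p─q⊆p (S - u) _

    pair∈S : ∀ {x y} → IsPair u v x y → x ∈ S
    pair∈S (inj₁ (refl , _)) = u∈S
    pair∈S (inj₂ (refl , _)) = v∈S

    pair-distinct : ∀ {x y} → IsPair u v x y → x ≢ y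
    pair-distinct (inj₁ (refl , refl)) = u≢v
    pair-distinct (inj₂ (refl , refl)) = u≢v ∘ sym

    pair-unique : ∀ {x y w} → IsPair u v x y → IsPair u v x w → y ≡ w
    pair-unique (inj₁ (_ , y≡v)) (inj₁ (_ , w≡v)) = trans y≡v (sym w≡v)
    pair-unique (inj₂ (_ , y≡u)) (inj₂ (_ , w≡u)) = trans y≡u (sym w≡u)
    pair-unique (inj₁ (x≡u , _)) (inj₂ (x≡v , _)) = contradiction (trans (sym x≡u) x≡v) u≢v
    pair-unique (inj₂ (x≡v , _)) (inj₁ (x≡u , _)) = contradiction (trans (sym x≡u) x≡v) u≢v

    fresh-clash : ∀ {x y w} → IsPair u v x y → c x w ≢ just k
    fresh-clash p cxw≡k = S-fresh I _ _ cxw≡k (pair∈S p)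

    colouring′ : IsColouring H c′
    symmetric colouring′ x y with recolour-cases c u v k x y | recolour-cases c u v k y x
    ... | inj₁ (_ , c′xy) | inj₁ (_ , c′yx) = trans c′xy (sym c′yx)
    ... | inj₂ (_ , c′xy) | inj₂ (_ , c′yx) = trans c′xy (trans (symmetric (colouring I) x y) (sym c′yx))
    ... | inj₁ (p , _)    | inj₂ (¬p , _)   = contradiction (IsPair-swap p) ¬p
    ... | inj₂ (¬p , _)   | inj₁ (p , _)    = contradiction (IsPair-swap p) ¬p
    loopless colouring′ x with recolour-cases c u v k x x
    ... | inj₁ (p , _)       = contradiction refl (pair-distinct p)
    ... | inj₂ (_ , c′xx≡c) = trans c′xx≡c (loopless (colouring I) x)
    matching colouring′ x y w c′xy≡j c′xw≡j
      with recolour-cases c u v k x y | recolour-cases c u v k x w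
    ... | inj₁ (p , _)       | inj₁ (q , _)       = pair-unique p q
    ... | inj₂ (_ , c′xy≡c) | inj₂ (_ , c′xw≡c) =
      matching (colouring I) x y w (trans (sym c′xy≡c) c′xy≡j) (trans (sym c′xw≡c) c′xw≡j)
    ... | inj₁ (p , c′xy≡k) | inj₂ (_ , c′xw≡c) with trans (sym c′xy≡k) c′xy≡j
    ...   | refl = contradiction (trans (sym c′xw≡c) c′xw≡j) (fresh-clash p)
    matching colouring′ x y w c′xy≡j c′xw≡j
        | inj₂ (_ , c′xy≡c) | inj₁ (q , c′xw≡k) with trans (sym c′xw≡k) c′xw≡j
    ...   | refl = contradiction (trans (sym c′xy≡c) c′xy≡j) (fresh-clash q)
    within colouring′ x y c′xy≡j with recolour-cases c u v k x y
    ... | inj₁ (p , c′xy≡k) with trans (sym c′xy≡k) c′xy≡j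
    ...   | refl = S⊆h I (pair∈S p) , S⊆h I (pair∈S (IsPair-swap p))
    within colouring′ x y c′xy≡j | inj₂ (_ , c′xy≡c) =
      within (colouring I) x y (trans (sym c′xy≡c) c′xy≡j)

    invariant′ : Invariant c′ S′
    colouring invariant′ = colouring′
    S⊆h       invariant′ = S⊆h I ∘ S′⊆S
    S-fresh   invariant′ x y c′xy≡k x∈S′ with recolour-cases c u v k x y
    ... | inj₁ (inj₁ (refl , _) , _) = x∉p-x S u (p─q⊆p (S - u) _ x∈S′)
    ... | inj₁ (inj₂ (refl , _) , _) = x∉p-x (S - u) v x∈S′
    ... | inj₂ (_ , c′xy≡c)          = S-fresh I x y (trans (sym c′xy≡c) c′xy≡k) (S′⊆S x∈S′)

    size : ∣ S ∣ ≡ 2 + ∣ S′ ∣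
    size = trans (∣p∣≡1+∣p-x∣ S u∈S) (cong suc (∣p∣≡1+∣p-x∣ (S - u) (x∈p∧x≢y⇒x∈p-y v∈S (u≢v ∘ sym))))

    gain : 2 + colouredPairs c ≤ colouredPairs c′
    gain = recolour-count c k u≢v uv-free (trans (symmetric (colouring I) v u) uv-free)

  UncolouredPair : Colouring n (length H) → Subset n → Set
  UncolouredPair c S = Σ (Fin n) λ u → Σ (Fin n) λ v → u ∈ S × v ∈ S × u ≢ v × c u v ≡ nothing

  uncolouredPair? : ∀ c S → Dec (UncolouredPair c S)
  uncolouredPair? c S = any? λ u → any? λ v →
    (u ∈? S) ×-dec (v ∈? S) ×-dec ¬? (u ≟ v) ×-dec ≡-dec _≟_ (c u v) nothing

  -- The outcome of saturating from (c , S): a colouring c′ and a fully coloured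
  -- set S′, where every vertex that left S was paid for by a coloured pair.
  Saturated : Colouring n (length H) → Subset n → Set
  Saturated c S = Σ (Colouring n (length H)) λ c′ → Σ (Subset n) λ S′ →
    IsColouring H c′ × FullyColoured c′ S′ × colouredPairs c + ∣ S ∣ ≤ colouredPairs c′ + ∣ S′ ∣

  -- Repeat the greedy step until no uncoloured pair remains; f bounds ∣ S ∣.
  saturate : ∀ f {c S} → ∣ S ∣ ≤ f → Invariant c S → Saturated c S
  saturate f {c} {S} _ I with uncolouredPair? c S
  ... | no none = c , S , colouring I , full , ≤-refl
    where
    full : FullyColoured c S
    full x y x∈S y∈S x≢y cxy-free = none (x , y , x∈S , y∈S , x≢y , cxy-free)
  saturate zero    ∣S∣≤0 I | yes (u , v , u∈S , v∈S , u≢v , uv-free) =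
    contradiction (subst (_≤ 0) (Step.size I u∈S v∈S u≢v uv-free) ∣S∣≤0) λ ()
  saturate (suc f) {c} {S} ∣S∣≤1+f I | yes (u , v , u∈S , v∈S , u≢v , uv-free)
    with saturate f (<⇒≤ (≤-pred (subst (_≤ suc f) size ∣S∣≤1+f))) invariant′
    where open Step I u∈S v∈S u≢v uv-free
  ... | c″ , S″ , colouring″ , full″ , paid″ = c″ , S″ , colouring″ , full″ , ≤-trans paid paid″
    where
    open Step I u∈S v∈S u≢v uv-free
    open ≤-Reasoning
    paid : colouredPairs c + ∣ S ∣ ≤ colouredPairs c′ + ∣ S′ ∣
    paid = begin
      colouredPairs c + ∣ S ∣          ≡⟨ cong (colouredPairs c +_) size ⟩
      colouredPairs c + (2 + ∣ S′ ∣)   ≡⟨ sym (+-assoc (colouredPairs c) 2 _) ⟩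
      (colouredPairs c + 2) + ∣ S′ ∣   ≡⟨ cong (_+ ∣ S′ ∣) (+-comm (colouredPairs c) 2) ⟩
      (2 + colouredPairs c) + ∣ S′ ∣   ≤⟨ +-monoˡ-≤ ∣ S′ ∣ gain ⟩
      colouredPairs c′ + ∣ S′ ∣        ∎

IsRainbow : ∀ {n m k} → Colouring n m → (Fin k → Fin n) → Set
IsRainbow c φ = ∀ a b a′ b′ → a Fin.< b → a′ Fin.< b′ → c (φ a) (φ b) ≡ c (φ a′) (φ b′) → a ≡ a′ × b ≡ b′

RainbowClique : ∀ {n m} → Colouring n m → Subset n → ℕ → Set
RainbowClique {n} c S k =
  Σ (Fin k → Fin n) λ φ → (∀ i → φ i ∈ S) × Injective _≡_ _≡_ φ × IsRainbow c φ

-- k(1 + k²) < (k + 1)³: the blocked vertices below never exhaust a set of size (k+1)³.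
k[1+k²]<[1+k]³ : ∀ k → k * suc (k * k) < suc k ^ 3
k[1+k²]<[1+k]³ k = subst (k * suc (k * k) <_) (sym (cube k)) (s≤s (m≤m+n _ _))
  where
  open +-*-Solver
  cube : ∀ k → suc k ^ 3 ≡ suc (k * suc (k * k) + (3 * (k * k) + 2 * k))
  cube = solve 1 (λ k → (con 1 :+ k) :^ 3 := con 1 :+ (k :* (con 1 :+ k :* k) :+ (con 3 :* (k :* k) :+ con 2 :* k))) refl

-- A rainbow clique φ of size k is
-- extended greedily: a vertex w is blocked only if it is a vertex of φ or
-- some edge w φi repeats the colour of an edge φa φb; each of these k(1 + k²)
-- possibilities blocks at most one vertex, by the matching property.
module Rainbow {n m} (c : Colouring n m)
  (symmetric : ∀ u v → c u v ≡ c v u)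
  (matching  : ∀ u v w {k} → c u v ≡ just k → c u w ≡ just k → v ≡ w)
  (S : Subset n) (full : FullyColoured c S) where

  determined : ∀ {x w w′} → x ∈ S → w ∈ S → w′ ∈ S → c x w ≡ c x w′ → w ≡ w′
  determined {x} {w} {w′} x∈S w∈S w′∈S cxw≡cxw′ with c x w in cxw
  ... | just _  = matching x w w′ cxw (sym cxw≡cxw′)
  ... | nothing = trans (uncoloured⇒≡x w∈S cxw) (sym (uncoloured⇒≡x w′∈S (sym cxw≡cxw′)))
    where
    uncoloured⇒≡x : ∀ {y} → y ∈ S → c x y ≡ nothing → y ≡ x
    uncoloured⇒≡x {y} y∈S cxy-free =
      decidable-stable (y ≟ x) (λ y≢x → full x y x∈S y∈S (y≢x ∘ sym) cxy-free)

  module Extension {k} (φ : Fin k → Fin n) (φ∈S : ∀ i → φ i ∈ S)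
                   (φ-inj : Injective _≡_ _≡_ φ) (rainbow : IsRainbow c φ) where

    Blocked : Fin n → Set
    Blocked w = (Σ (Fin k) λ i → w ≡ φ i)
              ⊎ (Σ (Fin k) λ i → Σ (Fin k) λ a → Σ (Fin k) λ b → c (φ i) w ≡ c (φ a) (φ b))

    blocked? : ∀ w → Dec (Blocked w)
    blocked? w = any? (λ i → w ≟ φ i)
      ⊎-dec any? λ i → any? λ a → any? λ b → ≡-dec _≟_ (c (φ i) w) (c (φ a) (φ b))

    -- The reason for a blockage, coded in Fin (k(1 + k²)); it determines the vertex.
    code : ∀ {w} → Blocked w → Fin (k * suc (k * k))
    code (inj₁ (i , _))         = combine i zero
    code (inj₂ (i , a , b , _)) = combine i (suc (combine a b))

    code-injective : ∀ {w w′} → w ∈ S → w′ ∈ S → (β : Blocked w) (β′ : Blocked w′) →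
      code β ≡ code β′ → w ≡ w′
    code-injective _ _ (inj₁ (i , w≡φi)) (inj₁ (i′ , w′≡φi′)) eq
      with refl ← proj₁ (combine-injective i zero i′ zero eq) = trans w≡φi (sym w′≡φi′)
    code-injective _ _ (inj₁ (i , _)) (inj₂ (i′ , _)) eq
      with () ← proj₂ (combine-injective i _ i′ _ eq)
    code-injective _ _ (inj₂ (i , _)) (inj₁ (i′ , _)) eq
      with () ← proj₂ (combine-injective i _ i′ _ eq)
    code-injective w∈S w′∈S (inj₂ (i , a , b , e)) (inj₂ (i′ , a′ , b′ , e′)) eq
      with refl , eq′ ← combine-injective i _ i′ _ eq
      with refl , refl ← combine-injective a b a′ b′ (suc-injective eq′)
      = determined (φ∈S i) w∈S w′∈S (trans e (sym e′))

    unblocked : k * suc (k * k) < ∣ S ∣ → Σ (Fin n) λ w → w ∈ S × ¬ Blocked w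
    unblocked big with any? (λ w → (w ∈? S) ×-dec ¬? (blocked? w))
    ... | yes found = found
    ... | no none   = contradiction (injective-on⇒∣S∣≤ S (λ w w∈S → code (blocked w∈S)) injective) (<⇒≱ big)
      where
      blocked : ∀ {w} → w ∈ S → Blocked w
      blocked {w} w∈S = decidable-stable (blocked? w) (λ free → none (w , w∈S , free))
      injective : ∀ w w′ w∈S w′∈S → code (blocked w∈S) ≡ code (blocked w′∈S) → w ≡ w′
      injective w w′ w∈S w′∈S = code-injective w∈S w′∈S (blocked w∈S) (blocked w′∈S)

    extend : ∀ {w} → w ∈ S → ¬ Blocked w → RainbowClique c S (suc k)
    extend {w} w∈S free = φ′ , φ′∈S , φ′-inj , rainbow′
      where
      φ′ : Fin (suc k) → Fin n
      φ′ zero    = w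
      φ′ (suc i) = φ i
      φ′∈S : ∀ i → φ′ i ∈ S
      φ′∈S zero    = w∈S
      φ′∈S (suc i) = φ∈S i
      φ′-inj : Injective _≡_ _≡_ φ′
      φ′-inj {zero}  {zero}  _   = refl
      φ′-inj {zero}  {suc j} w≡φj = contradiction (inj₁ (j , w≡φj)) free
      φ′-inj {suc i} {zero}  φi≡w = contradiction (inj₁ (i , sym φi≡w)) free
      φ′-inj {suc i} {suc j} φi≡φj = cong suc (φ-inj φi≡φj)
      rainbow′ : IsRainbow c φ′
      rainbow′ _ zero _ _ () _ _
      rainbow′ _ _ _ zero _ () _
      rainbow′ zero (suc b) zero (suc b′) _ _ same =
        refl , cong suc (φ-inj (determined w∈S (φ∈S b) (φ∈S b′) same))
      rainbow′ zero (suc b) (suc a′) (suc b′) _ _ same =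
        contradiction (inj₂ (b , a′ , b′ , trans (symmetric (φ b) w) same)) free
      rainbow′ (suc a) (suc b) zero (suc b′) _ _ same =
        contradiction (inj₂ (b′ , a , b , trans (symmetric (φ b′) w) (sym same))) free
      rainbow′ (suc a) (suc b) (suc a′) (suc b′) (s≤s a<b) (s≤s a′<b′) same
        with refl , refl ← rainbow a b a′ b′ a<b a′<b′ same = refl , refl

  rainbowClique : ∀ k → k ^ 3 ≤ ∣ S ∣ → RainbowClique c S k
  rainbowClique zero    _   = (λ ()) , (λ ()) , (λ {}) , λ ()
  rainbowClique (suc k) big
    with φ , φ∈S , φ-inj , rainbow ← rainbowClique k (≤-trans (^-monoˡ-≤ 3 (n≤1+n k)) big)
    with w , w∈S , free ← Extension.unblocked φ φ∈S φ-inj rainbow (≤-trans (k[1+k²]<[1+k]³ k) big)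
    = Extension.extend φ φ∈S φ-inj rainbow w∈S free

-- A rainbow r-clique of a colouring by the hyperedges of H is a Berge copy of
-- every graph F on r vertices: the edge ij of F goes to the hyperedge whose
-- colour the pair φi φj carries, and rainbowness makes this assignment injective.
rainbow⇒Berge : ∀ {r n} (F : Graph r) (H : Hypergraph n) {c S} → IsColouring H c →
  FullyColoured c S → RainbowClique c S r → ContainsBerge F H
rainbow⇒Berge F H {c} valid full (φ , φ∈S , φ-inj , rainbow) = φ , g , φ-inj , g-inj , g-contains
  where
  colour : (e : Edge F) → Σ (Fin (length H)) λ k → c (φ (proj₁ e)) (φ (proj₁ (proj₂ e))) ≡ just k
  colour (i , j , i<j , _) with c (φ i) (φ j) in cφiφj
  ... | just k  = k , refl
  ... | nothing = contradiction cφiφj (full _ _ (φ∈S i) (φ∈S j) (<⇒≢ i<j ∘ φ-inj))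
  g : Edge F → Fin (length H)
  g e = proj₁ (colour e)
  g-inj : ∀ e e′ → g e ≡ g e′ → edge-ends {G = F} e ≡ edge-ends {G = F} e′
  g-inj e@(i , j , i<j , _) e′@(i′ , j′ , i′<j′ , _) ge≡ge′
    with refl , refl ← rainbow i j i′ j′ i<j i′<j′
                         (trans (proj₂ (colour e)) (trans (cong just ge≡ge′) (sym (proj₂ (colour e′)))))
    = refl
  g-contains : ∀ (e : Edge F) → let (i , j) = edge-ends {G = F} e in
    (φ i ∈ lookup H (g e)) × (φ j ∈ lookup H (g e))
  g-contains e = within valid _ _ (proj₂ (colour e))

fullyColoured-small : ∀ {r n} (F : Graph r) (H : Hypergraph n) {c S} → Free F H →
  IsColouring H c → FullyColoured c S → ∣ S ∣ < r ^ 3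
fullyColoured-small {r} F H {c} {S} free valid full = ≰⇒> λ big →
  free (rainbow⇒Berge F H valid full (Rainbow.rainbowClique c (symmetric valid) (matching valid) S full r big))

-- Shifting colours by one turns a colouring of H into one of h ∷ H in which
-- the colour zero of h is still unused.
shift : ∀ {n m} → Colouring n m → Colouring n (suc m)
shift c x y = Maybe.map suc (c x y)

shift-just : ∀ {m} (x : Maybe (Fin m)) {k} → Maybe.map suc x ≡ just k →
  Σ (Fin m) λ k′ → x ≡ just k′ × k ≡ suc k′
shift-just (just k′) refl = k′ , refl , refl

shift-colouring : ∀ {n} {H : Hypergraph n} {c} h → IsColouring H c → IsColouring (h ∷ H) (shift c)
symmetric (shift-colouring h valid) x y = cong (Maybe.map suc) (symmetric valid x y)
loopless  (shift-colouring h valid) x   = cong (Maybe.map suc) (loopless valid x)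
matching  (shift-colouring {c = c} h valid) x y w cxy≡k cxw≡k
  with k , cxy , refl ← shift-just (c x y) cxy≡k
  with k′ , cxw , k≡k′ ← shift-just (c x w) cxw≡k
  with refl ← suc-injective k≡k′
  = matching valid x y w cxy cxw
within (shift-colouring {c = c} h valid) x y cxy≡k
  with k , cxy , refl ← shift-just (c x y) cxy≡k
  = within valid x y cxy

shift-fresh : ∀ {n m} (c : Colouring n m) x y → shift c x y ≢ just zero
shift-fresh c x y shift≡zero with shift-just (c x y) shift≡zero
... | _ , _ , ()

colouredPairs-shift : ∀ {n m} (c : Colouring n m) → colouredPairs (shift c) ≡ colouredPairs c
colouredPairs-shift {n} c = sumF-cong n λ u → sumF-cong n λ v → isColoured-shift u v
  where
  isColoured-shift : ∀ u v → isColoured (shift c u v) ≡ isColoured (c u v)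
  isColoured-shift u v with c u v
  ... | nothing = refl
  ... | just _  = refl

shift-invariant : ∀ {n} {H : Hypergraph n} {c} h → IsColouring H c →
  Saturation.Invariant (h ∷ H) zero (shift c) h
shift-invariant {c = c} h valid = record
  { colouring = shift-colouring h valid
  ; S⊆h       = λ x∈h → x∈h
  ; S-fresh   = λ x y shift≡zero _ → shift-fresh c x y shift≡zero
  }

-- Adding a hyperedge h to an F-free family: saturate h with its own colour; the
-- remaining fully coloured set has fewer than r³ vertices, and every other
-- vertex of h was paid for by a new coloured pair.
add-hyperedge : ∀ {r n} (F : Graph r) (h : Subset n) (H : Hypergraph n) {c} → Free F (h ∷ H) →
  IsColouring H c → Σ (Colouring n (suc (length H))) λ c′ →
    IsColouring (h ∷ H) c′ × colouredPairs c + ∣ h ∣ ≤ colouredPairs c′ + r ^ 3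
add-hyperedge {r} F h H {c} free valid
  with c′ , S′ , valid′ , full′ , paid ← Saturation.saturate (h ∷ H) zero ∣ h ∣ ≤-refl (shift-invariant h valid)
  = c′ , valid′ , (begin
    colouredPairs c + ∣ h ∣          ≡⟨ cong (_+ ∣ h ∣) (sym (colouredPairs-shift c)) ⟩
    colouredPairs (shift c) + ∣ h ∣  ≤⟨ paid ⟩
    colouredPairs c′ + ∣ S′ ∣        ≤⟨ +-monoʳ-≤ (colouredPairs c′) (<⇒≤ (fullyColoured-small F (h ∷ H) free valid′ full′)) ⟩
    colouredPairs c′ + r ^ 3         ∎)
  where open ≤-Reasoning

free-tail : ∀ {r n} (F : Graph r) (h : Subset n) (H : Hypergraph n) → Free F (h ∷ H) → Free F H
free-tail F h H free (φ , g , φ-inj , g-inj , g-contains) =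
  free (φ , suc ∘ g , φ-inj , (λ e e′ → g-inj e e′ ∘ suc-injective) , g-contains)

colourAll : ∀ {r n} (F : Graph r) (H : Hypergraph n) → Free F H →
  Σ (Colouring n (length H)) λ c →
    IsColouring H c × sum (map ∣_∣ H) ≤ colouredPairs c + r ^ 3 * length H
colourAll F []      _    = (λ _ _ → nothing) , uncoloured , z≤n
  where
  uncoloured : IsColouring [] (λ _ _ → nothing)
  uncoloured = record { symmetric = λ _ _ → refl ; loopless = λ _ → refl
                      ; matching = λ _ _ _ () ; within = λ _ _ () }
colourAll {r} F (h ∷ H) free
  with c , valid , bound ← colourAll F H (free-tail F h H free)
  with c′ , valid′ , paid ← add-hyperedge F h H free valid
  = c′ , valid′ , (begin
    ∣ h ∣ + sum (map ∣_∣ H)                  ≤⟨ +-monoʳ-≤ ∣ h ∣ bound ⟩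
    ∣ h ∣ + (colouredPairs c + R * length H)  ≡⟨ sym (+-assoc ∣ h ∣ _ _) ⟩
    (∣ h ∣ + colouredPairs c) + R * length H  ≡⟨ cong (_+ R * length H) (+-comm ∣ h ∣ _) ⟩
    (colouredPairs c + ∣ h ∣) + R * length H  ≤⟨ +-monoˡ-≤ (R * length H) paid ⟩
    (colouredPairs c′ + R) + R * length H     ≡⟨ +-assoc (colouredPairs c′) R _ ⟩
    colouredPairs c′ + (R + R * length H)     ≡⟨ cong (colouredPairs c′ +_) (sym (*-suc R _)) ⟩
    colouredPairs c′ + R * suc (length H)     ∎)
  where
  open ≤-Reasoning
  R = r ^ 3

lemma3 : ∀ {r n : ℕ} (F : Graph r) (H : Hypergraph n) →
    Free F H →
    All (λ h → r ^ 3 ≤ ∣ h ∣) H →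
    sum (map ∣_∣ H) ≤ 2 * (n C 2) + r ^ 3 * length H
lemma3 F H free _ with c , valid , bound ← colourAll F H free =
  ≤-trans bound (+-monoˡ-≤ _ (colouredPairs-bound c (loopless valid)))
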